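{- Let $G$ be a graph, $r \geq t$ integers, $(N,F)$ a near-far-labeling of $G$, and $c$ an $(r,t)$-threshold-coloring of $G$ with respect to $(N,F)$. Suppose $wxyzw$ is a cycle of length $4$ in $G$ (with edges $wx, xy, yz, zw$) such that $wx, yz \in F$ and $xy, zw \in N$. Then $c(w) > c(x)$ implies $c(z) > c(y)$.
   Context: All graphs are finite, simple and undirected. A near-far-labeling of $G$ is a pair $(N,F)$ with $N \subseteq E(G)$ and $F = E(G)\setminus N$. For integers $r \geq t$, an $(r,t)$-threshold-coloring of $G$ with respect to $(N,F)$ is a map $c: V(G) \to \{0,\ldots,r-1\}$ with $|c(u)-c(v)| \leq t$ for every $uv \in N$ and $|c(u)-c(v)| > t$ for every $uv \in F$. -}

module Defs where

open import Data.Fin using (Fin)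
open import Data.Nat using (ℕ)
open import Data.Integer using (ℤ; _-_; ∣_∣; +_; _≤_; _<_)
open import Data.Product using (_×_)
open import Relation.Nullary using (¬_)
open import Relation.Binary.PropositionalEquality using (_≡_)
open import Level using (0ℓ)

record Graph : Set₁ where
  field
    n    : ℕ
    Adj  : Fin n → Fin n → Set
    sym  : ∀ {u v} → Adj u v → Adj v u
    irr  : ∀ {u} → ¬ Adj u u

open Graph public

V : Graph → Set
V G = Fin (n G)

record NearFar (G : Graph) : Set₁ where
  field
    Near     : V G → V G → Set
    Near-sym : ∀ {u v} → Near u v → Near v u
    Near⊆E   : ∀ {u v} → Near u v → Adj G u v

open NearFar public

InN : {G : Graph} → NearFar G → V G → V G → Set
InN L u v = Near L u v

InF : {G : Graph} → NearFar G → V G → V G → Set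
InF {G} L u v = Adj G u v × ¬ Near L u v

dist : ℤ → ℤ → ℤ
dist a b = + ∣ a - b ∣

record IsThresholdColoring (G : Graph) (L : NearFar G) (r t : ℤ)
                           (c : V G → ℤ) : Set where
  field
    range-lo : ∀ v → + 0 ≤ c v
    range-hi : ∀ v → c v < r
    near     : ∀ {u v} → InN L u v → dist (c u) (c v) ≤ t
    far      : ∀ {u v} → InF L u v → t < dist (c u) (c v)

Is4Cycle : (G : Graph) → V G → V G → V G → V G → Set
Is4Cycle G w x y z =
  ¬ w ≡ x × ¬ w ≡ y × ¬ w ≡ z × ¬ x ≡ y × ¬ x ≡ z × ¬ y ≡ z ×
  Adj G w x × Adj G x y × Adj G y z × Adj G z w

-- Since c x < c w, the far edge wx forces c w > c x + t.  If c z ≤ c y, the far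
-- edge yz likewise forces c y > c z + t, and the near edges xy, zw close the cycle
-- of inequalities  c w ≤ c z + t < c y ≤ c x + t < c w.
module Submission where

open import Defs
open import Data.Integer using (ℤ; _≤_; _<_; _+_; _-_; +_; -[1+_]; ∣_∣; -≤+; _<?_)
open import Data.Integer.Properties
open import Data.Empty using (⊥-elim)
open import Data.Integer.Solver using (module +-*-Solver)
open import Relation.Binary.PropositionalEquality using (_≡_; refl; cong; subst)
open import Relation.Nullary using (yes; no)
open +-*-Solver using (solve; _:+_; _:-_; _:=_)

i-j+j≡i : ∀ i j → i - j + j ≡ i
i-j+j≡i = solve 2 (λ i j → i :- j :+ j := i) refl

i-j≤k⇒i≤k+j : ∀ {i j k} → i - j ≤ k → i ≤ k + j
i-j≤k⇒i≤k+j {i} {j} {k} h = subst (_≤ k + j) (i-j+j≡i i j) (+-monoˡ-≤ j h)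

k<i-j⇒k+j<i : ∀ {i j k} → k < i - j → k + j < i
k<i-j⇒k+j<i {i} {j} {k} h = subst (k + j <_) (i-j+j≡i i j) (+-monoˡ-< j h)

i≤+∣i∣ : ∀ i → i ≤ + ∣ i ∣
i≤+∣i∣ (+ n)    = ≤-refl
i≤+∣i∣ -[1+ n ] = -≤+

dist-comm : ∀ a b → dist a b ≡ dist b a
dist-comm a b = cong +_ (∣i-j∣≡∣j-i∣ a b)

dist≤⇒≤+ˡ : ∀ {a b t} → dist a b ≤ t → a ≤ t + b
dist≤⇒≤+ˡ {a} {b} h = i-j≤k⇒i≤k+j (≤-trans (i≤+∣i∣ (a - b)) h)

dist≤⇒≤+ʳ : ∀ {a b t} → dist a b ≤ t → b ≤ t + a
dist≤⇒≤+ʳ {a} {b} {t} h = dist≤⇒≤+ˡ (subst (_≤ t) (dist-comm a b) h)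

≥∧<dist⇒+< : ∀ {a b t} → b ≤ a → t < dist a b → t + b < a
≥∧<dist⇒+< {a} {b} {t} b≤a h =
  k<i-j⇒k+j<i (subst (t <_) (∣-∣-≤ b≤a) (subst (t <_) (dist-comm a b) h))

lemma1 : (G : Graph) (L : NearFar G) (r t : ℤ) → t ≤ r →
         (c : V G → ℤ) → IsThresholdColoring G L r t c →
         (w x y z : V G) → Is4Cycle G w x y z →
         InF L w x → InF L y z → InN L x y → InN L z w →
         c x < c w → c y < c z
lemma1 G L r t _ c col w x y z _ fwx fyz nxy nzw cx<cw with c y <? c z
... | yes cy<cz = cy<cz
... | no cy≮cz  = ⊥-elim (<-irrefl refl (begin-strict
  c w       ≤⟨ dist≤⇒≤+ʳ (near nzw) ⟩
  t + c z   <⟨ ≥∧<dist⇒+< (≮⇒≥ cy≮cz) (far fyz) ⟩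
  c y       ≤⟨ dist≤⇒≤+ʳ (near nxy) ⟩
  t + c x   <⟨ ≥∧<dist⇒+< (<⇒≤ cx<cw) (far fwx) ⟩
  c w       ∎))
  where
  open IsThresholdColoring col
  open ≤-Reasoning
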